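{- Let $e_1,e_2,e_3$ be nonzero integers with $e_1+e_2+e_3=0$, $e_1,e_2$ odd and $2\,\|\,e_3$. Let $n$ be an odd positive square-free integer and $\Lambda=(d_1,d_2,d_3)$ a triple of square-free integers dividing $2e_1e_2e_3n$ with $d_1d_2d_3$ a square. If $D_\Lambda^{(n)}(\mathbb Q_2)\neq\emptyset$, then $d_3$ is odd.
   Context: $D_\Lambda^{(n)}$ is the curve in $\mathbb P^3$ with coordinates $(t,u_1,u_2,u_3)$ defined by $e_1nt^2+d_2u_2^2-d_3u_3^2=0$, $e_2nt^2+d_3u_3^2-d_1u_1^2=0$, $e_3nt^2+d_1u_1^2-d_2u_2^2=0$. -}

module Defs where

open import Data.Nat as ℕ using (ℕ; suc)
open import Data.Nat.Primality using (Prime)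
open import Data.Integer as ℤ using (ℤ; +_; _+_; _-_; _*_; ∣_∣)
open import Data.Integer.Divisibility using (_∣_)
open import Data.Product using (Σ; ∃; _×_)
open import Data.Sum using (_⊎_)
open import Relation.Nullary using (¬_)
open import Relation.Binary.PropositionalEquality using (_≡_)

pow2 : ℕ → ℤ
pow2 k = + (2 ℕ.^ k)

-- Square-free integer: no square of a prime divides it (so 0 is not square-free).
SquareFree : ℤ → Set
SquareFree d = ∀ (p : ℕ) → Prime p → ¬ ((+ (p ℕ.* p)) ∣ d)

Odd : ℤ → Set
Odd d = ¬ ((+ 2) ∣ d)

IsSquare : ℤ → Set
IsSquare d = ∃ λ (m : ℤ) → d ≡ m * m

Exactly2 : ℤ → Set
Exactly2 e = ((+ 2) ∣ e) × ¬ ((+ 4) ∣ e)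

-- 2-adic integers as the inverse limit of ℤ/2^k: a sequence x with
-- x (k+1) ≡ x k (mod 2^k); x k represents the residue modulo 2^k.
record ℤ₂ : Set where
  field
    res      : ℕ → ℤ
    coherent : ∀ k → pow2 k ∣ (res (suc k) - res k)
open ℤ₂ public

IsZero₂ : ℤ₂ → Set
IsZero₂ x = ∀ k → pow2 k ∣ res x k

-- The three quadrics defining D_Λ^(n), as integer polynomials in (t,u1,u2,u3)
F₁ F₂ F₃ : (e₁ e₂ e₃ n d₁ d₂ d₃ : ℤ) → (t u₁ u₂ u₃ : ℤ) → ℤ
F₁ e₁ e₂ e₃ n d₁ d₂ d₃ t u₁ u₂ u₃ = e₁ * n * t * t + d₂ * u₂ * u₂ - d₃ * u₃ * u₃
F₂ e₁ e₂ e₃ n d₁ d₂ d₃ t u₁ u₂ u₃ = e₂ * n * t * t + d₃ * u₃ * u₃ - d₁ * u₁ * u₁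
F₃ e₁ e₂ e₃ n d₁ d₂ d₃ t u₁ u₂ u₃ = e₃ * n * t * t + d₁ * u₁ * u₁ - d₂ * u₂ * u₂

Vanishes₂ : (ℤ → ℤ → ℤ → ℤ → ℤ) → ℤ₂ → ℤ₂ → ℤ₂ → ℤ₂ → Set
Vanishes₂ F t u₁ u₂ u₃ =
  ∀ k → pow2 k ∣ F (res t k) (res u₁ k) (res u₂ k) (res u₃ k)

-- Every point of ℙ³(ℚ₂) has a representative with coordinates in ℤ₂ not all zero
-- (clear denominators), so we quantify over such representatives.
HasQ₂Point : (e₁ e₂ e₃ n d₁ d₂ d₃ : ℤ) → Set
HasQ₂Point e₁ e₂ e₃ n d₁ d₂ d₃ =
  Σ ℤ₂ λ t → Σ ℤ₂ λ u₁ → Σ ℤ₂ λ u₂ → Σ ℤ₂ λ u₃ →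
    (¬ (IsZero₂ t × IsZero₂ u₁ × IsZero₂ u₂ × IsZero₂ u₃)) ×
    Vanishes₂ (F₁ e₁ e₂ e₃ n d₁ d₂ d₃) t u₁ u₂ u₃ ×
    Vanishes₂ (F₂ e₁ e₂ e₃ n d₁ d₂ d₃) t u₁ u₂ u₃ ×
    Vanishes₂ (F₃ e₁ e₂ e₃ n d₁ d₂ d₃) t u₁ u₂ u₃

-- Suppose d₃ is even; being squarefree, d₃ = 2·odd.  As d₁d₂d₃ is a square, exactly one of d₁, d₂
-- is even, again 2·odd.  Then reducing the three equations first mod 2 and then mod 4 shows that
-- every common zero mod 4 has all coordinates even.  The forms being quadratic, every zero mod
-- 2^(2k) then has all coordinates divisible by 2^k, so every ℤ₂-point is 0 and D(ℚ₂) is empty.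
module Submission where

open import Defs
open import Data.Integer using (ℤ; +_; _+_; _*_; 0ℤ; _<_)
open import Data.Integer.Divisibility using (_∣_)
open import Relation.Nullary using (¬_)
open import Relation.Binary.PropositionalEquality using (_≡_)

open import Data.Nat as ℕ using (zero; suc)
import Data.Nat.Properties as ℕ
import Data.Nat.Divisibility as ℕ
open import Data.Nat.Primality using (Prime; prime?; euclidsLemma)
open import Data.Integer using (_-_; -_; ∣_∣)
open import Data.Integer.Properties using (abs-*; pos-*; neg-involutive; +-inverseʳ; *-comm; *-assoc; *-identityʳ; *-cancelˡ-≡)
open import Data.Integer.Divisibility.Signed as ∣′
  using (divides; ∣ᵤ⇒∣; ∣⇒∣ᵤ) renaming (_∣_ to _∣′_)
open import Data.Integer.Tactic.RingSolver using (solve-∀)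
open import Data.List using (List; []; _∷_)
open import Data.List.Relation.Unary.All as All using (All; []; _∷_)
open import Data.Sum as Sum using (_⊎_; [_,_]′; fromInj₂; reduce)
open import Data.Product using (Σ; _×_; _,_; proj₁; proj₂)
open import Data.Empty using (⊥-elim)
open import Function using (_∘_)
open import Relation.Nullary using (yes; no)
open import Relation.Nullary.Decidable using (from-yes)
open import Relation.Binary.PropositionalEquality using (refl; sym; trans; cong; subst; subst₂)
open Relation.Binary.PropositionalEquality.≡-Reasoning

∣m-n∣m⇒∣n : ∀ {i m n} → i ∣′ m - n → i ∣′ m → i ∣′ n
∣m-n∣m⇒∣n {i} {m} {n} i∣m-n i∣m =
  subst (i ∣′_) (neg-involutive n) (∣′.∣m⇒∣-m (∣′.∣m+n∣m⇒∣n {m = m} { - n} i∣m-n i∣m))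

∣x+y-z∣x∣y⇒∣z : ∀ {i x y z} → i ∣′ x + y - z → i ∣′ x → i ∣′ y → i ∣′ z
∣x+y-z∣x∣y⇒∣z h i∣x i∣y = ∣m-n∣m⇒∣n h (∣′.∣m∣n⇒∣m+n i∣x i∣y)

∣x+y-z∣z⇒∣x+y : ∀ {i x y z} → i ∣′ x + y - z → i ∣′ z → i ∣′ x + y
∣x+y-z∣z⇒∣x+y {x = x} {y} {z} h i∣z = ∣′.∣m+n∣n⇒∣m {m = x + y} { - z} h (∣′.∣m⇒∣-m i∣z)

∣x+y-z∣y∣z⇒∣x : ∀ {i x y z} → i ∣′ x + y - z → i ∣′ y → i ∣′ z → i ∣′ x
∣x+y-z∣y∣z⇒∣x {x = x} {y} {z} h i∣y i∣z = ∣′.∣m+n∣n⇒∣m {m = x} {y} (∣x+y-z∣z⇒∣x+y {x = x} {y} {z} h i∣z) i∣y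

∣x+y-z∣x∣z⇒∣y : ∀ {i x y z} → i ∣′ x + y - z → i ∣′ x → i ∣′ z → i ∣′ y
∣x+y-z∣x∣z⇒∣y {x = x} {y} {z} h i∣x i∣z = ∣′.∣m+n∣m⇒∣n {m = x} {y} (∣x+y-z∣z⇒∣x+y {x = x} {y} {z} h i∣z) i∣x

*-pres-∣′ : ∀ {i j m n} → i ∣′ m → j ∣′ n → i * j ∣′ m * n
*-pres-∣′ {i} {j} (divides p refl) (divides q refl) = divides (p * q) (interchange p i q j)
  where
  interchange : ∀ p i q j → p * i * (q * j) ≡ p * q * (i * j)
  interchange = solve-∀

Even : ℤ → Set
Even x = + 2 ∣′ x

TwiceOdd : ℤ → Set
TwiceOdd d = Σ ℤ λ δ → ¬ Even δ × d ≡ + 2 * δ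

odd⇒¬even : ∀ {x} → Odd x → ¬ Even x
odd⇒¬even odd = odd ∘ ∣⇒∣ᵤ

2-prime : Prime 2
2-prime = from-yes (prime? 2)

even-2* : ∀ x → Even (+ 2 * x)
even-2* x = ∣′.∣m⇒∣m*n x ∣′.∣-refl

even-*⇒even⊎even : ∀ m n → Even (m * n) → Even m ⊎ Even n
even-*⇒even⊎even m n 2∣mn =
  Sum.map ∣ᵤ⇒∣ ∣ᵤ⇒∣ (euclidsLemma ∣ m ∣ ∣ n ∣ 2-prime (subst (2 ℕ.∣_) (abs-* m n) (∣⇒∣ᵤ 2∣mn)))

¬even-* : ∀ {m n} → ¬ Even m → ¬ Even n → ¬ Even (m * n)
¬even-* {m} {n} ¬2∣m ¬2∣n = [ ¬2∣m , ¬2∣n ]′ ∘ even-*⇒even⊎even m n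

even-square⇒even : ∀ m → Even (m * m) → Even m
even-square⇒even m = reduce ∘ even-*⇒even⊎even m m

even-*²ˡ : ∀ {a} x → Even a → Even (a * x * x)
even-*²ˡ x 2∣a = ∣′.∣m⇒∣m*n x (∣′.∣m⇒∣m*n x 2∣a)

even-*²ʳ : ∀ a {x} → Even x → Even (a * x * x)
even-*²ʳ a {x} 2∣x = ∣′.∣n⇒∣m*n (a * x) 2∣x

even⇒4∣*² : ∀ a {x} → Even x → + 4 ∣′ a * x * x
even⇒4∣*² a 2∣x = *-pres-∣′ (∣′.∣n⇒∣m*n a 2∣x) 2∣x

even-*²⇒even : ∀ {a} x → ¬ Even a → Even (a * x * x) → Even x
even-*²⇒even {a} x ¬2∣a 2∣axx =
  fromInj₂ (fromInj₂ (⊥-elim ∘ ¬2∣a) ∘ even-*⇒even⊎even a x) (even-*⇒even⊎even (a * x) x 2∣axx)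

4∣⇒even : ∀ {x} → + 4 ∣′ x → Even x
4∣⇒even = ∣′.∣-trans (divides (+ 2) refl)

4∣2*⇒even : ∀ {x} → + 4 ∣′ + 2 * x → Even x
4∣2*⇒even = ∣′.*-cancelˡ-∣ (+ 2)

4∣twiceOdd*²⇒even : ∀ {d} x → TwiceOdd d → + 4 ∣′ d * x * x → Even x
4∣twiceOdd*²⇒even x (δ , ¬2∣δ , refl) 4∣d =
  even-*²⇒even x ¬2∣δ (4∣2*⇒even (subst (+ 4 ∣′_) (reassociate δ x) 4∣d))
  where
  reassociate : ∀ δ x → + 2 * δ * x * x ≡ + 2 * (δ * x * x)
  reassociate = solve-∀

squareFree-even⇒twiceOdd : ∀ {d} → SquareFree d → Even d → TwiceOdd d
squareFree-even⇒twiceOdd sf (divides δ d≡δ*2) = δ , ¬2∣δ , trans d≡δ*2 (*-comm δ (+ 2))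
  where
  ¬2∣δ : ¬ Even δ
  ¬2∣δ 2∣δ = sf 2 2-prime (∣⇒∣ᵤ (subst (+ 4 ∣′_) (sym d≡δ*2) (*-pres-∣′ 2∣δ ∣′.∣-refl)))

¬square-2*odd : ∀ {a} → ¬ Even a → ¬ IsSquare (+ 2 * a)
¬square-2*odd {a} ¬2∣a (m , 2a≡m²) = ¬2∣a (4∣2*⇒even (subst (+ 4 ∣′_) (sym 2a≡m²) (*-pres-∣′ 2∣m 2∣m)))
  where
  2∣m : Even m
  2∣m = even-square⇒even m (subst Even 2a≡m² (even-2* a))

-- Write m = 2μ; cancelling 4 from 8a = 4μ² leaves 2a = μ².
¬square-8*odd : ∀ {a} → ¬ Even a → ¬ IsSquare (+ 8 * a)
¬square-8*odd {a} ¬2∣a (m , 8a≡m²) with even-square⇒even m (subst Even 8a≡m² (∣′.∣m⇒∣m*n a (divides (+ 4) refl)))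
... | divides μ refl = ¬square-2*odd ¬2∣a (μ , *-cancelˡ-≡ (+ 4) (+ 2 * a) (μ * μ) 4[2a]≡4μ²)
  where
  4[2a]≡4μ² : + 4 * (+ 2 * a) ≡ + 4 * (μ * μ)
  4[2a]≡4μ² = begin
    + 4 * (+ 2 * a)     ≡⟨ sym (*-assoc (+ 4) (+ 2) a) ⟩
    + 8 * a             ≡⟨ 8a≡m² ⟩
    μ * + 2 * (μ * + 2) ≡⟨ square-double μ ⟩
    + 4 * (μ * μ)       ∎
    where
    square-double : ∀ μ → μ * + 2 * (μ * + 2) ≡ + 4 * (μ * μ)
    square-double = solve-∀

¬square-odd*odd*twiceOdd : ∀ {d₁ d₂ d₃} → ¬ Even d₁ → ¬ Even d₂ → TwiceOdd d₃ → ¬ IsSquare (d₁ * d₂ * d₃)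
¬square-odd*odd*twiceOdd {d₁} {d₂} ¬2∣d₁ ¬2∣d₂ (δ₃ , ¬2∣δ₃ , refl) =
  ¬square-2*odd (¬even-* (¬even-* ¬2∣d₁ ¬2∣d₂) ¬2∣δ₃) ∘ subst IsSquare (collect d₁ d₂ δ₃)
  where
  collect : ∀ d₁ d₂ δ₃ → d₁ * d₂ * (+ 2 * δ₃) ≡ + 2 * (d₁ * d₂ * δ₃)
  collect = solve-∀

¬square-twiceOdd³ : ∀ {d₁ d₂ d₃} → TwiceOdd d₁ → TwiceOdd d₂ → TwiceOdd d₃ → ¬ IsSquare (d₁ * d₂ * d₃)
¬square-twiceOdd³ (δ₁ , ¬2∣δ₁ , refl) (δ₂ , ¬2∣δ₂ , refl) (δ₃ , ¬2∣δ₃ , refl) =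
  ¬square-8*odd (¬even-* (¬even-* ¬2∣δ₁ ¬2∣δ₂) ¬2∣δ₃) ∘ subst IsSquare (collect δ₁ δ₂ δ₃)
  where
  collect : ∀ δ₁ δ₂ δ₃ → + 2 * δ₁ * (+ 2 * δ₂) * (+ 2 * δ₃) ≡ + 8 * (δ₁ * δ₂ * δ₃)
  collect = solve-∀

pow2-suc : ∀ k → pow2 (suc k) ≡ pow2 k * + 2
pow2-suc k = trans (cong +_ (ℕ.*-comm 2 (2 ℕ.^ k))) (pos-* (2 ℕ.^ k) 2)

pow2-∣-+ : ∀ d k → pow2 k ∣′ pow2 (d ℕ.+ k)
pow2-∣-+ zero    k = ∣′.∣-refl
pow2-∣-+ (suc d) k = subst (pow2 k ∣′_) (sym (pow2-suc (d ℕ.+ k))) (∣′.∣m⇒∣m*n (+ 2) (pow2-∣-+ d k))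

pow2-suc+suc : ∀ k → pow2 (suc k ℕ.+ suc k) ≡ + 4 * pow2 (k ℕ.+ k)
pow2-suc+suc k = begin
  pow2 (suc k ℕ.+ suc k)           ≡⟨ cong (pow2 ∘ suc) (ℕ.+-suc k k) ⟩
  + (2 ℕ.* (2 ℕ.* 2 ℕ.^ (k ℕ.+ k))) ≡⟨ cong +_ (sym (ℕ.*-assoc 2 2 (2 ℕ.^ (k ℕ.+ k)))) ⟩
  + (4 ℕ.* 2 ℕ.^ (k ℕ.+ k))         ≡⟨ pos-* 4 (2 ℕ.^ (k ℕ.+ k)) ⟩
  + 4 * pow2 (k ℕ.+ k)              ∎

res-coherent-+ : ∀ x d k → pow2 k ∣′ res x (d ℕ.+ k) - res x k
res-coherent-+ x zero    k = divides 0ℤ (+-inverseʳ (res x k))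
res-coherent-+ x (suc d) k =
  subst (pow2 k ∣′_) (sym (telescope (res x (suc d ℕ.+ k)) (res x (d ℕ.+ k)) (res x k)))
    (∣′.∣m∣n⇒∣m+n {m = res x (suc d ℕ.+ k) - res x (d ℕ.+ k)}
      (∣′.∣-trans (pow2-∣-+ d k) (∣ᵤ⇒∣ {pow2 (d ℕ.+ k)} (coherent x (d ℕ.+ k))))
      (res-coherent-+ x d k))
  where
  telescope : ∀ a b c → a - c ≡ (a - b) + (b - c)
  telescope = solve-∀

isZero₂-+ : ∀ x → (∀ k → pow2 k ∣′ res x (k ℕ.+ k)) → IsZero₂ x
isZero₂-+ x 2ᵏ∣x[k+k] k = ∣⇒∣ᵤ (∣m-n∣m⇒∣n (res-coherent-+ x k k) (2ᵏ∣x[k+k] k))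

Form : Set
Form = ℤ → ℤ → ℤ → ℤ → ℤ

Quadratic : Form → Set
Quadratic F = ∀ t u₁ u₂ u₃ → F (t * + 2) (u₁ * + 2) (u₂ * + 2) (u₃ * + 2) ≡ + 4 * F t u₁ u₂ u₃

ZeroMod : ℤ → List Form → ℤ → ℤ → ℤ → ℤ → Set
ZeroMod m Fs t u₁ u₂ u₃ = All (λ F → m ∣′ F t u₁ u₂ u₃) Fs

DividesAll : ℤ → ℤ → ℤ → ℤ → ℤ → Set
DividesAll m t u₁ u₂ u₃ = m ∣′ t × m ∣′ u₁ × m ∣′ u₂ × m ∣′ u₃

ZerosModDivisibleBy : List Form → ℤ → ℤ → Set
ZerosModDivisibleBy Fs m n = ∀ t u₁ u₂ u₃ → ZeroMod m Fs t u₁ u₂ u₃ → DividesAll n t u₁ u₂ u₃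

ZerosMod4AreEven : List Form → Set
ZerosMod4AreEven Fs = ZerosModDivisibleBy Fs (+ 4) (+ 2)

module _ {Fs : List Form} (quadratic : All Quadratic Fs) (zerosMod4AreEven : ZerosMod4AreEven Fs) where

  zeroMod-halve : ∀ m t u₁ u₂ u₃ → ZeroMod (+ 4 * m) Fs (t * + 2) (u₁ * + 2) (u₂ * + 2) (u₃ * + 2) →
                  ZeroMod m Fs t u₁ u₂ u₃
  zeroMod-halve m t u₁ u₂ u₃ zeros =
    All.zipWith (λ (F-quadratic , 4m∣F) → ∣′.*-cancelˡ-∣ (+ 4) (subst (_ ∣′_) (F-quadratic t u₁ u₂ u₃) 4m∣F))
                (quadratic , zeros)

  zerosModDivisibleBy-4*-*2 : ∀ {m n} → ZerosModDivisibleBy Fs m n → ZerosModDivisibleBy Fs (+ 4 * m) (n * + 2)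
  zerosModDivisibleBy-4*-*2 {m} {n} divisible t u₁ u₂ u₃ zeros
    with zerosMod4AreEven t u₁ u₂ u₃ (All.map (∣′.∣-trans (∣′.∣m⇒∣m*n m ∣′.∣-refl)) zeros)
  ... | divides t′ refl , divides u₁′ refl , divides u₂′ refl , divides u₃′ refl
    with divisible t′ u₁′ u₂′ u₃′ (zeroMod-halve m t′ u₁′ u₂′ u₃′ zeros)
  ... | n∣t′ , n∣u₁′ , n∣u₂′ , n∣u₃′ = double n∣t′ , double n∣u₁′ , double n∣u₂′ , double n∣u₃′
    where
    double : ∀ {x} → n ∣′ x → n * + 2 ∣′ x * + 2
    double = ∣′.*-monoˡ-∣ (+ 2)

  zerosModDivisibleBy-pow2 : ∀ k → ZerosModDivisibleBy Fs (pow2 (k ℕ.+ k)) (pow2 k)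
  zerosModDivisibleBy-pow2 zero    t u₁ u₂ u₃ _ = 1∣′ t , 1∣′ u₁ , 1∣′ u₂ , 1∣′ u₃
    where
    1∣′ : ∀ x → + 1 ∣′ x
    1∣′ x = divides x (sym (*-identityʳ x))
  zerosModDivisibleBy-pow2 (suc k) =
    subst₂ (ZerosModDivisibleBy Fs) (sym (pow2-suc+suc k)) (sym (pow2-suc k))
      (zerosModDivisibleBy-4*-*2 (zerosModDivisibleBy-pow2 k))

  onlyTrivialZero₂ : ∀ t u₁ u₂ u₃ → All (λ F → Vanishes₂ F t u₁ u₂ u₃) Fs →
                     IsZero₂ t × IsZero₂ u₁ × IsZero₂ u₂ × IsZero₂ u₃
  onlyTrivialZero₂ t u₁ u₂ u₃ vanish =
    isZero₂-+ t (proj₁ ∘ divisible) , isZero₂-+ u₁ (proj₁ ∘ proj₂ ∘ divisible) ,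
    isZero₂-+ u₂ (proj₁ ∘ proj₂ ∘ proj₂ ∘ divisible) , isZero₂-+ u₃ (proj₂ ∘ proj₂ ∘ proj₂ ∘ divisible)
    where
    divisible : ∀ k → DividesAll (pow2 k) (res t (k ℕ.+ k)) (res u₁ (k ℕ.+ k)) (res u₂ (k ℕ.+ k)) (res u₃ (k ℕ.+ k))
    divisible k = zerosModDivisibleBy-pow2 k _ _ _ _ (All.map (λ F-vanishes → ∣ᵤ⇒∣ (F-vanishes (k ℕ.+ k))) vanish)

curve : (e₁ e₂ e₃ n d₁ d₂ d₃ : ℤ) → List Form
curve e₁ e₂ e₃ n d₁ d₂ d₃ = F₁ e₁ e₂ e₃ n d₁ d₂ d₃ ∷ F₂ e₁ e₂ e₃ n d₁ d₂ d₃ ∷ F₃ e₁ e₂ e₃ n d₁ d₂ d₃ ∷ []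

diagonal-double : ∀ a b c x y z →
  a * (x * + 2) * (x * + 2) + b * (y * + 2) * (y * + 2) - c * (z * + 2) * (z * + 2) ≡ + 4 * (a * x * x + b * y * y - c * z * z)
diagonal-double = solve-∀

curve-quadratic : ∀ e₁ e₂ e₃ n d₁ d₂ d₃ → All Quadratic (curve e₁ e₂ e₃ n d₁ d₂ d₃)
curve-quadratic e₁ e₂ e₃ n d₁ d₂ d₃ =
  (λ t u₁ u₂ u₃ → diagonal-double (e₁ * n) d₂ d₃ t u₂ u₃) ∷
  (λ t u₁ u₂ u₃ → diagonal-double (e₂ * n) d₃ d₁ t u₃ u₁) ∷
  (λ t u₁ u₂ u₃ → diagonal-double (e₃ * n) d₁ d₂ t u₁ u₂) ∷ []

-- Mod 2, F₂ and then F₁ give t and u₂ even; mod 4, F₁ and then F₂ give u₃ and u₁ even.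
zerosMod4AreEven-odd-d₂ : ∀ e₁ e₂ e₃ n d₁ d₂ d₃ → ¬ Even (e₁ * n) → ¬ Even (e₂ * n) →
  TwiceOdd d₁ → ¬ Even d₂ → TwiceOdd d₃ → ZerosMod4AreEven (curve e₁ e₂ e₃ n d₁ d₂ d₃)
zerosMod4AreEven-odd-d₂ e₁ e₂ e₃ n _ d₂ _ ¬2∣a₁ ¬2∣a₂ d₁′@(δ₁ , _ , refl) ¬2∣d₂ d₃′@(δ₃ , _ , refl)
  t u₁ u₂ u₃ (4∣F₁ ∷ 4∣F₂ ∷ _ ∷ []) = 2∣t , 2∣u₁ , 2∣u₂ , 2∣u₃
  where
  2∣t : Even t
  2∣t = even-*²⇒even t ¬2∣a₂ (∣x+y-z∣y∣z⇒∣x (4∣⇒even 4∣F₂) (even-*²ˡ u₃ (even-2* δ₃)) (even-*²ˡ u₁ (even-2* δ₁)))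
  2∣u₂ : Even u₂
  2∣u₂ = even-*²⇒even u₂ ¬2∣d₂ (∣x+y-z∣x∣z⇒∣y (4∣⇒even 4∣F₁) (even-*²ʳ (e₁ * n) 2∣t) (even-*²ˡ u₃ (even-2* δ₃)))
  2∣u₃ : Even u₃
  2∣u₃ = 4∣twiceOdd*²⇒even u₃ d₃′ (∣x+y-z∣x∣y⇒∣z 4∣F₁ (even⇒4∣*² (e₁ * n) 2∣t) (even⇒4∣*² d₂ 2∣u₂))
  2∣u₁ : Even u₁
  2∣u₁ = 4∣twiceOdd*²⇒even u₁ d₁′ (∣x+y-z∣x∣y⇒∣z 4∣F₂ (even⇒4∣*² (e₂ * n) 2∣t) (even⇒4∣*² (+ 2 * δ₃) 2∣u₃))

-- Mod 2, F₁ and then F₂ give t and u₁ even; mod 4, F₃ and then F₁ give u₂ and u₃ even.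
zerosMod4AreEven-odd-d₁ : ∀ e₁ e₂ e₃ n d₁ d₂ d₃ → ¬ Even (e₁ * n) →
  ¬ Even d₁ → TwiceOdd d₂ → TwiceOdd d₃ → ZerosMod4AreEven (curve e₁ e₂ e₃ n d₁ d₂ d₃)
zerosMod4AreEven-odd-d₁ e₁ e₂ e₃ n d₁ _ _ ¬2∣a₁ ¬2∣d₁ d₂′@(δ₂ , _ , refl) d₃′@(δ₃ , _ , refl)
  t u₁ u₂ u₃ (4∣F₁ ∷ 4∣F₂ ∷ 4∣F₃ ∷ []) = 2∣t , 2∣u₁ , 2∣u₂ , 2∣u₃
  where
  2∣t : Even t
  2∣t = even-*²⇒even t ¬2∣a₁ (∣x+y-z∣y∣z⇒∣x (4∣⇒even 4∣F₁) (even-*²ˡ u₂ (even-2* δ₂)) (even-*²ˡ u₃ (even-2* δ₃)))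
  2∣u₁ : Even u₁
  2∣u₁ = even-*²⇒even u₁ ¬2∣d₁ (∣x+y-z∣x∣y⇒∣z (4∣⇒even 4∣F₂) (even-*²ʳ (e₂ * n) 2∣t) (even-*²ˡ u₃ (even-2* δ₃)))
  2∣u₂ : Even u₂
  2∣u₂ = 4∣twiceOdd*²⇒even u₂ d₂′ (∣x+y-z∣x∣y⇒∣z 4∣F₃ (even⇒4∣*² (e₃ * n) 2∣t) (even⇒4∣*² d₁ 2∣u₁))
  2∣u₃ : Even u₃
  2∣u₃ = 4∣twiceOdd*²⇒even u₃ d₃′ (∣x+y-z∣x∣y⇒∣z 4∣F₁ (even⇒4∣*² (e₁ * n) 2∣t) (even⇒4∣*² (+ 2 * δ₂) 2∣u₂))

¬hasQ₂Point : ∀ e₁ e₂ e₃ n d₁ d₂ d₃ →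
  ZerosMod4AreEven (curve e₁ e₂ e₃ n d₁ d₂ d₃) → ¬ HasQ₂Point e₁ e₂ e₃ n d₁ d₂ d₃
¬hasQ₂Point e₁ e₂ e₃ n d₁ d₂ d₃ zerosMod4AreEven (t , u₁ , u₂ , u₃ , nonzero , F₁=0 , F₂=0 , F₃=0) =
  nonzero (onlyTrivialZero₂ (curve-quadratic e₁ e₂ e₃ n d₁ d₂ d₃) zerosMod4AreEven
             t u₁ u₂ u₃ (F₁=0 ∷ F₂=0 ∷ F₃=0 ∷ []))

twiceOdd-d₃⇒¬hasQ₂Point : ∀ e₁ e₂ e₃ n d₁ d₂ d₃ → ¬ Even (e₁ * n) → ¬ Even (e₂ * n) →
  SquareFree d₁ → SquareFree d₂ → TwiceOdd d₃ → IsSquare (d₁ * d₂ * d₃) → ¬ HasQ₂Point e₁ e₂ e₃ n d₁ d₂ d₃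
twiceOdd-d₃⇒¬hasQ₂Point e₁ e₂ e₃ n d₁ d₂ d₃ ¬2∣a₁ ¬2∣a₂ sf₁ sf₂ d₃′ square point
  with + 2 ∣′.∣? d₁ | + 2 ∣′.∣? d₂
... | yes 2∣d₁ | yes 2∣d₂ =
  ¬square-twiceOdd³ (squareFree-even⇒twiceOdd sf₁ 2∣d₁) (squareFree-even⇒twiceOdd sf₂ 2∣d₂) d₃′ square
... | no ¬2∣d₁ | no ¬2∣d₂ = ¬square-odd*odd*twiceOdd ¬2∣d₁ ¬2∣d₂ d₃′ square
... | yes 2∣d₁ | no ¬2∣d₂ =
  ¬hasQ₂Point e₁ e₂ e₃ n d₁ d₂ d₃
    (zerosMod4AreEven-odd-d₂ e₁ e₂ e₃ n d₁ d₂ d₃ ¬2∣a₁ ¬2∣a₂ (squareFree-even⇒twiceOdd sf₁ 2∣d₁) ¬2∣d₂ d₃′) point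
... | no ¬2∣d₁ | yes 2∣d₂ =
  ¬hasQ₂Point e₁ e₂ e₃ n d₁ d₂ d₃
    (zerosMod4AreEven-odd-d₁ e₁ e₂ e₃ n d₁ d₂ d₃ ¬2∣a₁ ¬2∣d₁ (squareFree-even⇒twiceOdd sf₂ 2∣d₂) d₃′) point

lemma3p1 : (e₁ e₂ e₃ : ℤ) → ¬ (e₁ ≡ 0ℤ) → ¬ (e₂ ≡ 0ℤ) → ¬ (e₃ ≡ 0ℤ) →
    e₁ + e₂ + e₃ ≡ 0ℤ → Odd e₁ → Odd e₂ → Exactly2 e₃ →
    (n : ℤ) → 0ℤ < n → Odd n → SquareFree n →
    (d₁ d₂ d₃ : ℤ) → SquareFree d₁ → SquareFree d₂ → SquareFree d₃ →
    d₁ ∣ ((+ 2) * e₁ * e₂ * e₃ * n) → d₂ ∣ ((+ 2) * e₁ * e₂ * e₃ * n) →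
    d₃ ∣ ((+ 2) * e₁ * e₂ * e₃ * n) → IsSquare (d₁ * d₂ * d₃) →
    HasQ₂Point e₁ e₂ e₃ n d₁ d₂ d₃ →
    Odd d₃
lemma3p1 e₁ e₂ e₃ _ _ _ _ odd-e₁ odd-e₂ _ n _ odd-n _ d₁ d₂ d₃ sf₁ sf₂ sf₃ _ _ _ square point 2∣d₃ =
  twiceOdd-d₃⇒¬hasQ₂Point e₁ e₂ e₃ n d₁ d₂ d₃ (odd-*n e₁ odd-e₁) (odd-*n e₂ odd-e₂) sf₁ sf₂
    (squareFree-even⇒twiceOdd sf₃ (∣ᵤ⇒∣ 2∣d₃)) square point
  where
  odd-*n : ∀ e → Odd e → ¬ Even (e * n)
  odd-*n e odd-e = ¬even-* {e} {n} (odd⇒¬even odd-e) (odd⇒¬even odd-n)
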